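{- Let $(G,\pi)$ be a parity game, $\tau$ a strategy for Odd, $T$ an ordered tree of height $h=d/2$, and $\mathcal{C}$ a cover of $\mathcal{T}$. Let $C$ be an even cycle in $G_\tau$ with $\Pi(C)=\{v_1,\dots,v_\ell\}$ and let $j=\pi(C)/2$. Decompose $C$ into arc-disjoint paths $P_1,\dots,P_\ell$ such that each $P_i$ ends at $v_i$. Then $\alpha^k(C)=\max_{i\in[\ell]}\alpha^k(P_i)$ for all $0\le k<|\mathcal{C}_j|$.
   Context: A parity game: finite directed graph $G=(V,E)$, every node with an outgoing arc, $V=V_0\sqcup V_1$, priorities $\pi:V\to\{1,\dots,d\}$, $d$ even. A strategy for Odd is $\tau:V_1\to V$ with $v\tau(v)\in E$; $G_\tau=(V,E_\tau)$ with $E_\tau=\{vw\in E:v\in V_0\}\cup\{v\tau(v):v\in V_1\}$. A strategy for Even is $\sigma:V_0\to V$ with $v\sigma(v)\in E$; $G_\sigma$ keeps all arcs out of $V_1$ and only $v\sigma(v)$ out of $v\in V_0$. For a subgraph $H$, $\pi(H)$ is its maximum priority, $H$ is even if $\pi(H)$ is even, and $\Pi(H)$ is the set of nodes of $H$ of priority $\pi(H)$. Ordered trees: prefix-closed sets of tuples over a linearly ordered set, viewed as rooted trees, ordered lexicographically; in a tree of height $h$ all leaves are at depth $h$, a leaf is $\xi=(\xi_{2h-1},\dots,\xi_1)$, $\xi|_p$ deletes the components with index $<p$; $L(T)$ = leaves; $\bar L(T)=L(T)\cup\{\top\}$ with $\top$ maximal and $\top|_p=\top$. $T\sqsubseteq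 T'$ if there is an injective, edge-preserving, order-preserving map $V(T)\to V(T')$ mapping leaves to leaves; $T\equiv T'$ if $T\sqsubseteq T'$ and $T'\sqsubseteq T$; $T\sqsubset T'$ if $T\sqsubseteq T'$ and $T\not\equiv T'$. For labels from an ordered tree $S$ (of height at least half the relevant priorities), an arc $vw$ is non-violated w.r.t. a labeling $\nu$ into $\bar L(S)$ if ($\pi(v)$ even and $\nu(v)|_{\pi(v)}\ge\nu(w)|_{\pi(v)}$) or ($\pi(v)$ odd and ($\nu(v)|_{\pi(v)}>\nu(w)|_{\pi(v)}$ or $\nu(v)=\nu(w)=\top$)). $\nu$ is feasible in a subgraph $H$ if there is an Even strategy $\sigma$ with $v\sigma(v)\in E(H)$ for each $v\in V_0$ with an outgoing arc in $H$, such that all arcs of $H$ in $G_\sigma$ are non-violated; it is finite if it never takes value $\top$. For $0\le j\le h$, $\mathcal{T}_j$ is the set of pairwise non-equivalent (w.r.t. $\equiv$) subtrees of $T$ rooted at vertices of depth $h-j$, and $\mathcal{T}=\bigcup_j\mathcal{T}_j$. A cover of $\mathcal{T}_j$ is a tuple $\mathcal{C}_j=(\mathcal{C}^0_j,\dots,\mathcal{C}^\ell_j)$ of chains in the poset $(\mathcal{T}_j,\sqsubseteq)$ whose union is $\mathcal{T}_j$; a cover of $\mathcal{T}$ is a tuple $\mathcal{C}=(\mathcal{C}_0,\dots,\mathcal{C}_h)$ with each $\mathcal{C}_j$ a cover of $\mathcal{T}_j$. The trees of the chain $\mathcal{C}^k_j$ are denoted $T^k_{0,j}\sqsubset T^k_{1,j}\sqsubset\cdots\sqsubset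 T^k_{|\mathcal{C}^k_j|-1,j}$. For a subgraph $H$ of $G_\tau$ with $j=\lceil\pi(H)/2\rceil$ and a chain $\mathcal{C}^k_j$, the $k$th-width $\alpha^k(H)$ is the smallest $i\ge0$ such that $H$ admits a finite feasible node labeling $\nu:V(H)\to L(T^k_{i,j})$, and $\infty$ if none exists. -}

module Defs where

open import Function using (_∘_)
open import Data.Nat using (ℕ; zero; suc; _*_; _∸_; _≤_; _<_; _≤?_; _⊔_; ⌈_/2⌉; ⌊_/2⌋; _%_)
open import Data.Fin using (Fin)
import Data.Fin as F
open import Data.List using (List; []; _∷_; _++_; length; map; foldr; concat; last; allFin)
open import Data.List.Membership.Propositional using (_∈_)
open import Data.List.Relation.Unary.Linked using (Linked)
open import Data.List.Relation.Unary.AllPairs using (AllPairs)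
open import Data.List.Relation.Unary.Unique.Propositional using (Unique)
open import Data.List.Relation.Binary.Permutation.Propositional using (_↭_)
open import Data.Maybe using (Maybe; just; nothing)
open import Data.Product using (Σ; Σ-syntax; ∃; ∃-syntax; _×_; _,_)
open import Data.Sum using (_⊎_)
open import Relation.Nullary using (¬_; yes; no)
open import Relation.Binary.PropositionalEquality using (_≡_)

data Player : Set where
  even odd : Player

-- V = Fin n, V₀ = nodes owned by 'even', V₁ = nodes owned by 'odd'.
record Game : Set₁ where
  field
    n      : ℕ
    E      : Fin n → Fin n → Set
    total  : ∀ v → ∃[ w ] E v w
    owner  : Fin n → Player
    d      : ℕ
    d-even : d % 2 ≡ 0
    π      : Fin n → ℕ
    π-ge1  : ∀ v → 1 ≤ π v
    π-le   : ∀ v → π v ≤ d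

module _ (G : Game) where
  open Game G

  Node : Set
  Node = Fin n

  OddStrategy : Set
  OddStrategy = (v : Node) → owner v ≡ odd → Node

  IsOddStrategy : OddStrategy → Set
  IsOddStrategy τ = ∀ v (p : owner v ≡ odd) → E v (τ v p)

  EvenStrategy : Set
  EvenStrategy = (v : Node) → owner v ≡ even → Node

  Eτ : OddStrategy → Node → Node → Set
  Eτ τ v w = (owner v ≡ even × E v w) ⊎ (Σ[ p ∈ owner v ≡ odd ] w ≡ τ v p)

  Eσ : EvenStrategy → Node → Node → Set
  Eσ σ v w = (owner v ≡ odd × E v w) ⊎ (Σ[ p ∈ owner v ≡ even ] w ≡ σ v p)

data At {A : Set} : List A → ℕ → A → Set where
  here  : ∀ {x xs} → At (x ∷ xs) 0 x
  there : ∀ {x y xs i} → At xs i x → At (y ∷ xs) (suc i) x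

-- A finite ordered rooted tree; a vertex is identified
-- with the tuple of (0-based) positions of the children on the path from
-- the root, which is a prefix-closed set of tuples over the linearly
-- ordered set ℕ.

data OTree : Set where
  node : List OTree → OTree

data SubAt : OTree → List ℕ → OTree → Set where
  root : ∀ {t} → SubAt t [] t
  step : ∀ {ts i t p s} → At ts i t → SubAt t p s → SubAt (node ts) (i ∷ p) s

IsVertex : OTree → List ℕ → Set
IsVertex t p = ∃[ s ] SubAt t p s

IsLeaf : OTree → List ℕ → Set
IsLeaf t p = SubAt t p (node [])

HasHeight : OTree → ℕ → Set
HasHeight t h = ∀ p → IsLeaf t p → length p ≡ h

data _<lex_ : List ℕ → List ℕ → Set where
  []<∷  : ∀ {y ys} → [] <lex (y ∷ ys)
  head< : ∀ {x y xs ys} → x < y → (x ∷ xs) <lex (y ∷ ys)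
  tail< : ∀ {x xs ys} → xs <lex ys → (x ∷ xs) <lex (x ∷ ys)

_≤lex_ : List ℕ → List ℕ → Set
xs ≤lex ys = xs <lex ys ⊎ xs ≡ ys

Adjacent : List ℕ → List ℕ → Set
Adjacent p q = (∃[ i ] q ≡ p ++ i ∷ []) ⊎ (∃[ i ] p ≡ q ++ i ∷ [])

record Embedding (T T' : OTree) (f : List ℕ → List ℕ) : Set where
  field
    vert : ∀ p → IsVertex T p → IsVertex T' (f p)
    inj  : ∀ p q → IsVertex T p → IsVertex T q → f p ≡ f q → p ≡ q
    edge : ∀ p q → IsVertex T p → IsVertex T q → Adjacent p q → Adjacent (f p) (f q)
    mono : ∀ p q → IsVertex T p → IsVertex T q → p ≤lex q → f p ≤lex f q
    leaf : ∀ p → IsLeaf T p → IsLeaf T' (f p)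

_⊑_ : OTree → OTree → Set
T ⊑ T' = ∃[ f ] Embedding T T' f

_≅_ : OTree → OTree → Set
T ≅ T' = T ⊑ T' × T' ⊑ T

_⊏_ : OTree → OTree → Set
T ⊏ T' = T ⊑ T' × ¬ (T ≅ T')

record IsTj (T : OTree) (h j : ℕ) (R : List OTree) : Set where
  field
    sub      : ∀ s → s ∈ R → ∃[ p ] (length p ≡ h ∸ j × SubAt T p s)
    distinct : AllPairs (λ s s' → ¬ (s ≅ s')) R
    complete : ∀ p s → length p ≡ h ∸ j → SubAt T p s → ∃[ s' ] (s' ∈ R × s ≅ s')

record IsCoverOf (R : List OTree) (Cs : List (List OTree)) : Set where
  field
    chain  : ∀ c → c ∈ Cs → Linked _⊏_ c
    inR    : ∀ c s → c ∈ Cs → s ∈ c → s ∈ R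
    covers : ∀ s → s ∈ R → ∃[ c ] (c ∈ Cs × s ∈ c)

-- ξ|_p for a leaf ξ = (ξ_{2h-1}, …, ξ_1): delete components of index < p.
-- The head of a list of length m+1 has index 2m+1.
restrict : ℕ → List ℕ → List ℕ
restrict p [] = []
restrict p (x ∷ xs) with p ≤? suc (2 * length xs)
... | yes _ = x ∷ restrict p xs
... | no  _ = restrict p xs

-- L̄ = L ∪ {⊤}, with ⊤ = nothing
Lbar : Set
Lbar = Maybe (List ℕ)

restrictBar : ℕ → Lbar → Lbar
restrictBar p nothing  = nothing
restrictBar p (just ξ) = just (restrict p ξ)

data _<̄_ : Lbar → Lbar → Set where
  fin<    : ∀ {a b} → a <lex b → just a <̄ just b
  fin<top : ∀ {a} → just a <̄ nothing

_≥̄_ : Lbar → Lbar → Set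
x ≥̄ y = y <̄ x ⊎ x ≡ y

module _ (G : Game) where
  open Game G

  record Subgraph : Set where
    field
      nodes : List (Node G)
      arcs  : List (Node G × Node G)
  open Subgraph public

  πmax : Subgraph → ℕ
  πmax H = foldr _⊔_ 0 (map π (nodes H))

  NonViolated : (Node G → Lbar) → Node G → Node G → Set
  NonViolated ν v w =
      (π v % 2 ≡ 0 × restrictBar (π v) (ν v) ≥̄ restrictBar (π v) (ν w))
    ⊎ (π v % 2 ≡ 1 × (restrictBar (π v) (ν w) <̄ restrictBar (π v) (ν v)
                      ⊎ (ν v ≡ nothing × ν w ≡ nothing)))

  Feasible : Subgraph → (Node G → Lbar) → Set
  Feasible H ν = Σ[ σ ∈ EvenStrategy G ]
      ( (∀ v (p : owner v ≡ even) → E v (σ v p))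
      × (∀ v (p : owner v ≡ even) → (∃[ w ] (v , w) ∈ arcs H) → (v , σ v p) ∈ arcs H)
      × (∀ v w → (v , w) ∈ arcs H → Eσ G σ v w → NonViolated ν v w))

  AdmitsFinite : Subgraph → OTree → Set
  AdmitsFinite H S = Σ[ ν ∈ (Node G → List ℕ) ]
      ((∀ v → v ∈ nodes H → IsLeaf S (ν v)) × Feasible H (λ v → just (ν v)))

data ℕ∞ : Set where
  fin : ℕ → ℕ∞
  ∞   : ℕ∞

_⊔∞_ : ℕ∞ → ℕ∞ → ℕ∞
fin a ⊔∞ fin b = fin (a ⊔ b)
fin _ ⊔∞ ∞     = ∞
∞     ⊔∞ _     = ∞

max∞ : (ℓ : ℕ) → (Fin ℓ → ℕ∞) → ℕ∞
max∞ zero    a = fin 0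
max∞ (suc ℓ) a = a F.zero ⊔∞ max∞ ℓ (a ∘ F.suc)

module _ (G : Game) where
  open Game G

  WidthIn : List OTree → Subgraph G → ℕ∞ → Set
  WidthIn ch H (fin i) = Σ[ S ∈ OTree ] (At ch i S × AdmitsFinite G H S
                          × (∀ i' S' → i' < i → At ch i' S' → ¬ AdmitsFinite G H S'))
  WidthIn ch H ∞ = ∀ i S → At ch i S → ¬ AdmitsFinite G H S

  WidthIs : (ℕ → List (List OTree)) → ℕ → Subgraph G → ℕ∞ → Set
  WidthIs 𝒞 k H a = Σ[ ch ∈ List OTree ] (At (𝒞 ⌈ πmax G H /2⌉) k ch × WidthIn ch H a)

  walkArcs : List (Node G) → List (Node G × Node G)
  walkArcs (x ∷ y ∷ xs) = (x , y) ∷ walkArcs (y ∷ xs)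
  walkArcs _ = []

  cycArcs : List (Node G) → List (Node G × Node G)
  cycArcs [] = []
  cycArcs (c ∷ cs) = walkArcs ((c ∷ cs) ++ c ∷ [])

  cycleSub : List (Node G) → Subgraph G
  cycleSub cs = record { nodes = cs ; arcs = cycArcs cs }

  pathSub : List (Node G) → Subgraph G
  pathSub ps = record { nodes = ps ; arcs = walkArcs ps }

  IsCycleIn : OddStrategy G → List (Node G) → Set
  IsCycleIn τ cs = 1 ≤ length cs × Unique cs × (∀ v w → (v , w) ∈ cycArcs cs → Eτ G τ v w)

  Enumerates-Π : List (Node G) → (ℓ : ℕ) → (Fin ℓ → Node G) → Set
  Enumerates-Π cs ℓ v =
      (∀ i i' → v i ≡ v i' → i ≡ i')
    × (∀ i → v i ∈ cs × π (v i) ≡ πmax G (cycleSub cs))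
    × (∀ x → x ∈ cs → π x ≡ πmax G (cycleSub cs) → ∃[ i ] v i ≡ x)

  IsDecomposition : List (Node G) → (ℓ : ℕ) → (Fin ℓ → Node G) → (Fin ℓ → List (Node G)) → Set
  IsDecomposition cs ℓ v P =
      (∀ i → 2 ≤ length (P i))
    × (∀ i → last (P i) ≡ just (v i))
    × (concat (map (walkArcs ∘ P) (allFin ℓ)) ↭ cycArcs cs)

-- All widths here are taken along one chain T₀ ⊏ T₁ ⊏ ⋯ of trees of height j = π(C)/2.
-- On a subgraph of a cycle of G_τ Even has no choice, so feasibility just says that every
-- arc is non-violated; hence a labelling of C restricts to every Pᵢ, and α(Pᵢ) ≤ α(C).
-- An embedding T_m ⊑ T_{m'} of trees of equal height commutes with every truncation
-- ξ ↦ ξ|_p, so feasibility of a path persists up the chain, and all Pᵢ have labellings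
-- into the tree of index max αᵢ.  These glue: label a node by the path containing its
-- incoming arc.  An arc xy whose tail is not one of the vᵢ then lies on the path of the
-- incoming arc of x; if x = vᵢ, then π(x) = 2j truncates every label to the empty tuple,
-- so xy is non-violated anyway.

module Submission where

open import Defs
open import Function using (_∘_)
open import Data.Nat
  using (ℕ; zero; suc; _+_; _*_; _∸_; _≤_; _<_; _≤?_; _≟_; _⊔_; _%_; ⌈_/2⌉; ⌊_/2⌋; z≤n; s≤s)
open import Data.Nat.Properties
  using ( <-irrefl; ≤-trans; ≤-antisym; ≤-reflexive; ≤-total; ≮⇒≥; ≰⇒>; n≤1+n; 1+n≰n
        ; m≤m⊔n; m≤n⊔m; ⊔-lub; ⊔-identityʳ; m≤n⇒m⊔n≡n; m≥n⇒m⊔n≡m; m≤n⇒m⊓n≡m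
        ; +-comm; +-suc; +-cancelʳ-≡; m+n∸m≡n; m∸[m∸n]≡n; *-cancelˡ-≤ )
open import Data.Nat.DivMod using ([m+n]%n≡m%n)
open import Data.Fin using (Fin)
import Data.Fin as F
open import Data.List
  using (List; []; _∷_; _++_; _∷ʳ_; [_]; length; map; foldr; concat; last; allFin; take; drop)
open import Data.List.Properties
  using (++-assoc; ++-identityʳ; ++-identityʳ-unique; length-++; length-take; take++drop≡id)
open import Data.List.Membership.Propositional using (_∈_; find; lose)
open import Data.List.Membership.Propositional.Properties
  using (∈-map⁺; ∈-map⁻; ∈-++⁺ʳ; ∈-concat⁺′; ∈-concat⁻′; ∈-allFin)
open import Data.List.Relation.Unary.Any using (Any; here; there; any?)
open import Data.List.Relation.Unary.All using () renaming (lookup to All-lookup)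
import Data.List.Relation.Unary.All.Properties as All
open import Data.List.Relation.Unary.Linked using (Linked; _∷_)
import Data.List.Relation.Unary.Linked as Linked
open import Data.List.Relation.Unary.Unique.Propositional using (Unique; _∷_)
import Data.List.Relation.Unary.Unique.Propositional.Properties as Unique
open import Data.List.Relation.Binary.Permutation.Propositional using (_↭_; ↭-sym; ↭⇒↭ₛ)
open import Data.List.Relation.Binary.Permutation.Propositional.Properties using (∈-resp-↭; ∷↭∷ʳ)
import Data.List.Relation.Binary.Permutation.Setoid.Properties as PermutationSetoid
open import Data.Maybe using (just)
open import Data.Maybe.Properties using (just-injective)
open import Data.Product using (Σ-syntax; ∃-syntax; _×_; _,_; proj₁; proj₂)
open import Data.Sum using (_⊎_; inj₁; inj₂)
open import Data.Empty using (⊥-elim)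
open import Relation.Nullary using (¬_; Dec; yes; no)
import Relation.Nullary.Decidable as Dec
open import Relation.Binary.Definitions using (DecidableEquality)
open import Relation.Binary.PropositionalEquality
  using (_≡_; _≢_; refl; sym; trans; cong; subst; subst₂; setoid; module ≡-Reasoning)

<lex-irrefl : ∀ {xs} → ¬ xs <lex xs
<lex-irrefl (head< x<x)   = <-irrefl refl x<x
<lex-irrefl (tail< xs<xs) = <lex-irrefl xs<xs

<lex-∷ʳ : ∀ xs x → xs <lex (xs ∷ʳ x)
<lex-∷ʳ []       x = []<∷
<lex-∷ʳ (y ∷ xs) x = tail< (<lex-∷ʳ xs x)

∷ʳ-≮lex : ∀ xs x → ¬ (xs ∷ʳ x) <lex xs
∷ʳ-≮lex []       x ()
∷ʳ-≮lex (y ∷ xs) x (head< y<y) = <-irrefl refl y<y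
∷ʳ-≮lex (y ∷ xs) x (tail< lt)  = ∷ʳ-≮lex xs x lt

∷ʳ-≢ : ∀ (xs : List ℕ) x → xs ∷ʳ x ≢ xs
∷ʳ-≢ xs x eq with ++-identityʳ-unique xs (sym eq)
... | ()

take-length-++ : ∀ {A : Set} (xs ys : List A) → take (length xs) (xs ++ ys) ≡ xs
take-length-++ []       ys = refl
take-length-++ (x ∷ xs) ys = cong (x ∷_) (take-length-++ xs ys)

length≡0⇒[] : ∀ {A : Set} {xs : List A} → length xs ≡ 0 → xs ≡ []
length≡0⇒[] {xs = []} _ = refl

last-∈ : ∀ {A : Set} (xs : List A) {x} → last xs ≡ just x → x ∈ xs
last-∈ (y ∷ [])     refl = here refl
last-∈ (y ∷ z ∷ xs) eq   = there (last-∈ (z ∷ xs) eq)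

At-functional : ∀ {A : Set} {xs : List A} {n x y} → At xs n x → At xs n y → x ≡ y
At-functional here      here      = refl
At-functional (there a) (there b) = At-functional a b

At⇒∈ : ∀ {A : Set} {xs : List A} {n x} → At xs n x → x ∈ xs
At⇒∈ here      = here refl
At⇒∈ (there a) = there (At⇒∈ a)

module _ {A : Set} (_≟_ : DecidableEquality A) (R : List (A × A)) where

  successor? : ∀ x → Dec (∃[ y ] (x , y) ∈ R)
  successor? x = Dec.map′ found (λ (y , xy∈) → lose xy∈ refl) (any? (λ a → proj₁ a ≟ x) R)
    where
      found : Any (λ a → proj₁ a ≡ x) R → ∃[ y ] (x , y) ∈ R
      found any with find any
      ... | (_ , y) , xy∈ , refl = y , xy∈

  predecessor? : ∀ y → Dec (∃[ x ] (x , y) ∈ R)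
  predecessor? y = Dec.map′ found (λ (x , xy∈) → lose xy∈ refl) (any? (λ a → proj₂ a ≟ y) R)
    where
      found : Any (λ a → proj₂ a ≡ y) R → ∃[ x ] (x , y) ∈ R
      found any with find any
      ... | (x , _) , xy∈ , refl = x , xy∈

module _ {A : Set} where

  Unique-resp-↭ : ∀ {xs ys : List A} → Unique xs → xs ↭ ys → Unique ys
  Unique-resp-↭ u p = PermutationSetoid.Unique-resp-↭ (setoid A) (↭⇒↭ₛ p) u

  Unique-map⇒injective : ∀ {B : Set} (f : A → B) {xs a b} → Unique (map f xs) →
                         a ∈ xs → b ∈ xs → f a ≡ f b → a ≡ b
  Unique-map⇒injective f _        (here refl) (here refl) _  = refl
  Unique-map⇒injective f (fx∉ ∷ _) (here refl) (there b∈) eq = ⊥-elim (All-lookup (All.map⁻ fx∉) b∈ eq)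
  Unique-map⇒injective f (fx∉ ∷ _) (there a∈) (here refl) eq = ⊥-elim (All-lookup (All.map⁻ fx∉) a∈ (sym eq))
  Unique-map⇒injective f (_ ∷ u)   (there a∈) (there b∈)  eq = Unique-map⇒injective f u a∈ b∈ eq

  Unique-++⇒disjoint : ∀ (xs : List A) {ys a} → Unique (xs ++ ys) → a ∈ xs → ¬ a ∈ ys
  Unique-++⇒disjoint (x ∷ xs) (x∉ ∷ _) (here refl) a∈ys = All-lookup x∉ (∈-++⁺ʳ xs a∈ys) refl
  Unique-++⇒disjoint (x ∷ xs) (_ ∷ u)  (there a∈) a∈ys  = Unique-++⇒disjoint xs u a∈ a∈ys

  Unique-++⁻ʳ : ∀ (xs : List A) {ys} → Unique (xs ++ ys) → Unique ys
  Unique-++⁻ʳ []       u       = u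
  Unique-++⁻ʳ (x ∷ xs) (_ ∷ u) = Unique-++⁻ʳ xs u

  Unique-concat⇒disjoint : ∀ {I : Set} (g : I → List A) (xs : List I) {i i' b} →
                           Unique (concat (map g xs)) →
                           i ∈ xs → i' ∈ xs → b ∈ g i → b ∈ g i' → i ≡ i'
  Unique-concat⇒disjoint g (x ∷ xs) u (here refl) (here refl) _ _ = refl
  Unique-concat⇒disjoint g (x ∷ xs) u (here refl) (there i'∈) b∈ b∈' =
    ⊥-elim (Unique-++⇒disjoint (g x) u b∈ (∈-concat⁺′ b∈' (∈-map⁺ g i'∈)))
  Unique-concat⇒disjoint g (x ∷ xs) u (there i∈) (here refl) b∈ b∈' =
    ⊥-elim (Unique-++⇒disjoint (g x) u b∈' (∈-concat⁺′ b∈ (∈-map⁺ g i∈)))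
  Unique-concat⇒disjoint g (x ∷ xs) u (there i∈) (there i'∈) b∈ b∈' =
    Unique-concat⇒disjoint g xs (Unique-++⁻ʳ (g x) u) i∈ i'∈ b∈ b∈'

2*suc : ∀ n → 2 * suc n ≡ suc (suc (2 * n))
2*suc n = cong suc (+-suc n (n + 0))

2*⌈n/2⌉≡n : ∀ n → n % 2 ≡ 0 → 2 * ⌈ n /2⌉ ≡ n
2*⌈n/2⌉≡n zero          _  = refl
2*⌈n/2⌉≡n (suc (suc n)) ev = trans (2*suc ⌈ n /2⌉) (cong (suc ∘ suc) (2*⌈n/2⌉≡n n n%2≡0))
  where
    n%2≡0 : n % 2 ≡ 0
    n%2≡0 = trans (sym ([m+n]%n≡m%n n 2)) (trans (cong (_% 2) (+-comm n 2)) ev)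

-- Ordered trees

SubAt-++ : ∀ {t p s q r} → SubAt t p s → SubAt s q r → SubAt t (p ++ q) r
SubAt-++ root       b = b
SubAt-++ (step a x) b = step a (SubAt-++ x b)

SubAt⇒IsVertex-prefix : ∀ {t} p {q r} → SubAt t (p ++ q) r → IsVertex t p
SubAt⇒IsVertex-prefix {t} []      _          = t , root
SubAt⇒IsVertex-prefix     (i ∷ p) (step a x) =
  let s , sub = SubAt⇒IsVertex-prefix p x in s , step a sub

IsVertex-prefix : ∀ {t} p {q} → IsVertex t (p ++ q) → IsVertex t p
IsVertex-prefix p (_ , sub) = SubAt⇒IsVertex-prefix p sub

IsVertex-take : ∀ {t} n {p} → IsVertex t p → IsVertex t (take n p)
IsVertex-take n {p} vp = IsVertex-prefix (take n p) (subst (IsVertex _) (sym (take++drop≡id n p)) vp)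

IsLeaf⇒IsVertex : ∀ {t p} → IsLeaf t p → IsVertex t p
IsLeaf⇒IsVertex leaf = node [] , leaf

HasHeight-SubAt : ∀ {T h p s j} → HasHeight T h → SubAt T p s → length p ≡ h ∸ j → j ≤ h → HasHeight s j
HasHeight-SubAt {h = h} {p} {j = j} hT sub |p| j≤h q leaf = begin
  length q                             ≡⟨ sym (m+n∸m≡n (length p) (length q)) ⟩
  length p + length q ∸ length p       ≡⟨ cong (_∸ length p) (sym (length-++ p)) ⟩
  length (p ++ q) ∸ length p           ≡⟨ cong (_∸ length p) (hT (p ++ q) (SubAt-++ sub leaf)) ⟩
  h ∸ length p                         ≡⟨ cong (h ∸_) |p| ⟩
  h ∸ (h ∸ j)                          ≡⟨ m∸[m∸n]≡n j≤h ⟩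
  j                                    ∎
  where open ≡-Reasoning

cover-HasHeight : ∀ {T h j R Cs ch S} → HasHeight T h → j ≤ h → IsTj T h j R → IsCoverOf R Cs →
                  ch ∈ Cs → S ∈ ch → HasHeight S j
cover-HasHeight hT j≤h 𝒯j 𝒞j ch∈ S∈ =
  let _ , |p| , sub = IsTj.sub 𝒯j _ (IsCoverOf.inR 𝒞j _ _ ch∈ S∈)
  in HasHeight-SubAt hT sub |p| j≤h

-- Truncations ξ|_p

restrict-[] : ∀ p xs → 2 * length xs ≤ p → restrict p xs ≡ []
restrict-[] p []       _  = refl
restrict-[] p (x ∷ xs) le with p ≤? suc (2 * length xs)
... | yes p≤ = ⊥-elim (1+n≰n (≤-trans (subst (_≤ p) (2*suc (length xs)) le) p≤))
... | no  _  = restrict-[] p xs (≤-trans (n≤1+n _) (≤-trans (n≤1+n _) (subst (_≤ p) (2*suc (length xs)) le)))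

restrictLength : ℕ → ℕ → ℕ
restrictLength p zero    = 0
restrictLength p (suc n) with p ≤? suc (2 * n)
... | yes _ = suc (restrictLength p n)
... | no  _ = 0

restrictLength≤ : ∀ p n → restrictLength p n ≤ n
restrictLength≤ p zero    = z≤n
restrictLength≤ p (suc n) with p ≤? suc (2 * n)
... | yes _ = s≤s (restrictLength≤ p n)
... | no  _ = z≤n

restrict≡take : ∀ p xs → restrict p xs ≡ take (restrictLength p (length xs)) xs
restrict≡take p []       = refl
restrict≡take p (x ∷ xs) with p ≤? suc (2 * length xs)
... | yes _  = cong (x ∷_) (restrict≡take p xs)
... | no  p≰ = restrict-[] p xs (≤-trans (n≤1+n _) (≤-trans (n≤1+n _) (≰⇒> p≰)))

IsVertex-restrict : ∀ {t ξ} p → IsVertex t ξ → IsVertex t (restrict p ξ)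
IsVertex-restrict {ξ = ξ} p vξ = subst (IsVertex _) (sym (restrict≡take p ξ)) (IsVertex-take _ vξ)

-- Embeddings of ordered trees

⊑-refl : ∀ S → S ⊑ S
⊑-refl S = (λ p → p) , record
  { vert = λ _ v → v ; inj = λ _ _ _ _ e → e ; edge = λ _ _ _ _ a → a
  ; mono = λ _ _ _ _ l → l ; leaf = λ _ l → l }

⊑-trans : ∀ {S S' S''} → S ⊑ S' → S' ⊑ S'' → S ⊑ S''
⊑-trans (f , e) (g , e') = g ∘ f , record
  { vert = λ p v → E'.vert (f p) (E.vert p v)
  ; inj  = λ p q vp vq eq → E.inj p q vp vq (E'.inj (f p) (f q) (E.vert p vp) (E.vert q vq) eq)
  ; edge = λ p q vp vq a → E'.edge (f p) (f q) (E.vert p vp) (E.vert q vq) (E.edge p q vp vq a)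
  ; mono = λ p q vp vq l → E'.mono (f p) (f q) (E.vert p vp) (E.vert q vq) (E.mono p q vp vq l)
  ; leaf = λ p l → E'.leaf (f p) (E.leaf p l) }
  where module E = Embedding e
        module E' = Embedding e'

Linked⊏-head-⊑ : ∀ {S Ss n S'} → Linked _⊏_ (S ∷ Ss) → At (S ∷ Ss) n S' → S ⊑ S'
Linked⊏-head-⊑ {S} _        here      = ⊑-refl S
Linked⊏-head-⊑     (r ∷ ch) (there a) = ⊑-trans (proj₁ r) (Linked⊏-head-⊑ ch a)

Linked⊏-⊑ : ∀ {Ss m n S S'} → Linked _⊏_ Ss → At Ss m S → At Ss n S' → m ≤ n → S ⊑ S'
Linked⊏-⊑ ch here      a'         _         = Linked⊏-head-⊑ ch a'
Linked⊏-⊑ ch (there a) (there a') (s≤s m≤n) = Linked⊏-⊑ (Linked.tail ch) a a' m≤n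

module EmbeddingProperties {S S' : OTree} {f : List ℕ → List ℕ} (e : Embedding S S' f) where
  open Embedding e

  -- f p is adjacent to f (p ∷ʳ x) and below it in the order, so it is its parent.
  f-∷ʳ : ∀ p x → IsVertex S (p ∷ʳ x) → ∃[ y ] f (p ∷ʳ x) ≡ f p ∷ʳ y
  f-∷ʳ p x v with edge p (p ∷ʳ x) (IsVertex-prefix p v) v (inj₁ (x , refl))
  ... | inj₁ (y , eq) = y , eq
  ... | inj₂ (y , eq) with mono p (p ∷ʳ x) (IsVertex-prefix p v) v (inj₁ (<lex-∷ʳ p x))
  ...   | inj₁ lt  = ⊥-elim (∷ʳ-≮lex _ y (subst (_<lex f (p ∷ʳ x)) eq lt))
  ...   | inj₂ eq' = ⊥-elim (∷ʳ-≢ _ y (trans (sym eq) eq'))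

  f-++ : ∀ p q → IsVertex S (p ++ q) → ∃[ r ] (f (p ++ q) ≡ f p ++ r × length r ≡ length q)
  f-++ p []      _ = [] , trans (cong f (++-identityʳ p)) (sym (++-identityʳ (f p))) , refl
  f-++ p (x ∷ q) v =
    let assoc = sym (++-assoc p [ x ] q)
        v'    = subst (IsVertex S) assoc v
        r , fpxq≡ , |r| = f-++ (p ∷ʳ x) q v'
        y , fpx≡ = f-∷ʳ p x (IsVertex-prefix (p ∷ʳ x) v')
    in y ∷ r , (begin
         f (p ++ x ∷ q)       ≡⟨ cong f assoc ⟩
         f ((p ∷ʳ x) ++ q)    ≡⟨ fpxq≡ ⟩
         f (p ∷ʳ x) ++ r      ≡⟨ cong (_++ r) fpx≡ ⟩
         (f p ∷ʳ y) ++ r      ≡⟨ ++-assoc (f p) [ y ] r ⟩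
         f p ++ y ∷ r         ∎) , cong suc |r|
    where open ≡-Reasoning

  f-take-prefix : ∀ p q → IsVertex S (p ++ q) → take (length (f p)) (f (p ++ q)) ≡ f p
  f-take-prefix p q v with f-++ p q v
  ... | r , eq , _ = trans (cong (take _) eq) (take-length-++ (f p) r)

  f-mono-< : ∀ {p q} → IsVertex S p → IsVertex S q → p <lex q → f p <lex f q
  f-mono-< vp vq lt with mono _ _ vp vq (inj₁ lt)
  ... | inj₁ lt' = lt'
  ... | inj₂ eq  = ⊥-elim (<lex-irrefl (subst (_<lex _) (inj _ _ vp vq eq) lt))

  module _ {j} (hS : HasHeight S j) (hS' : HasHeight S' j) where

    f-[] : ∀ {ξ} → IsLeaf S ξ → f [] ≡ []
    f-[] {ξ} leafξ with f-++ [] ξ (IsLeaf⇒IsVertex leafξ)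
    ... | r , fξ≡ , |r| = length≡0⇒[] (+-cancelʳ-≡ (length ξ) (length (f [])) 0 (begin
      length (f []) + length ξ    ≡⟨ cong (length (f []) +_) (sym |r|) ⟩
      length (f []) + length r    ≡⟨ sym (length-++ (f [])) ⟩
      length (f [] ++ r)          ≡⟨ cong length (sym fξ≡) ⟩
      length (f ξ)                ≡⟨ hS' _ (leaf ξ leafξ) ⟩
      j                           ≡⟨ sym (hS ξ leafξ) ⟩
      length ξ                    ∎))
      where open ≡-Reasoning

    length-f : ∀ {ξ p} → IsLeaf S ξ → IsVertex S p → length (f p) ≡ length p
    length-f leafξ vp with f-++ [] _ vp
    ... | r , eq , |r| = trans (cong length (trans eq (cong (_++ r) (f-[] leafξ)))) |r|

    f-take : ∀ {ξ} → IsLeaf S ξ → ∀ c → c ≤ length ξ → take c (f ξ) ≡ f (take c ξ)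
    f-take {ξ} leafξ c c≤ = begin
      take c (f ξ)                                             ≡⟨ cong (take c ∘ f) (sym (take++drop≡id c ξ)) ⟩
      take c (f (take c ξ ++ drop c ξ))                        ≡⟨ cong (λ n → take n (f (take c ξ ++ drop c ξ))) (sym |f[take]|) ⟩
      take (length (f (take c ξ))) (f (take c ξ ++ drop c ξ))  ≡⟨ f-take-prefix _ _ v ⟩
      f (take c ξ)                                             ∎
      where
        open ≡-Reasoning
        v : IsVertex S (take c ξ ++ drop c ξ)
        v = subst (IsVertex S) (sym (take++drop≡id c ξ)) (IsLeaf⇒IsVertex leafξ)
        |f[take]| : length (f (take c ξ)) ≡ c
        |f[take]| = trans (length-f leafξ (IsVertex-prefix _ v)) (trans (length-take c ξ) (m≤n⇒m⊓n≡m c≤))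

    f-restrict : ∀ {ξ} → IsLeaf S ξ → ∀ p → restrict p (f ξ) ≡ f (restrict p ξ)
    f-restrict {ξ} leafξ p = begin
      restrict p (f ξ)                              ≡⟨ restrict≡take p (f ξ) ⟩
      take (restrictLength p (length (f ξ))) (f ξ)  ≡⟨ cong (λ n → take (restrictLength p n) (f ξ)) |fξ| ⟩
      take (restrictLength p (length ξ)) (f ξ)      ≡⟨ f-take leafξ _ (restrictLength≤ p (length ξ)) ⟩
      f (take (restrictLength p (length ξ)) ξ)      ≡⟨ cong f (sym (restrict≡take p ξ)) ⟩
      f (restrict p ξ)                              ∎
      where
        open ≡-Reasoning
        |fξ| = length-f leafξ (IsLeaf⇒IsVertex leafξ)

-- Non-violated arcs, feasibility and admissibility

module _ (G : Game) where
  open Game G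

  NonViolated-cong : ∀ {ν ν' : Node G → Lbar} {v w} → ν v ≡ ν' v → ν w ≡ ν' w →
                     NonViolated G ν v w → NonViolated G ν' v w
  NonViolated-cong {ν} {ν'} {v} {w} eqv eqw = transport
    where
      r = restrictBar (π v)
      r< : r (ν w) <̄ r (ν v) → r (ν' w) <̄ r (ν' v)
      r< = subst₂ _<̄_ (cong r eqw) (cong r eqv)
      transport : NonViolated G ν v w → NonViolated G ν' v w
      transport (inj₁ (ev , inj₁ lt))        = inj₁ (ev , inj₁ (r< lt))
      transport (inj₁ (ev , inj₂ eq))        = inj₁ (ev , inj₂ (trans (cong r (sym eqv)) (trans eq (cong r eqw))))
      transport (inj₂ (od , inj₁ lt))        = inj₂ (od , inj₁ (r< lt))
      transport (inj₂ (od , inj₂ (⊤v , ⊤w))) = inj₂ (od , inj₂ (trans (sym eqv) ⊤v , trans (sym eqw) ⊤w))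

  NonViolated-embed : ∀ {S S' f j} → Embedding S S' f → HasHeight S j → HasHeight S' j →
                      (ν : Node G → List ℕ) → ∀ {x y} → IsLeaf S (ν x) → IsLeaf S (ν y) →
                      NonViolated G (just ∘ ν) x y → NonViolated G (just ∘ f ∘ ν) x y
  NonViolated-embed {f = f} e hS hS' ν {x} {y} leafx leafy = transport
    where
      open EmbeddingProperties e
      r = restrict (π x)
      r∘f : ∀ {z} → IsLeaf _ (ν z) → r (f (ν z)) ≡ f (r (ν z))
      r∘f leaf = f-restrict hS hS' leaf (π x)
      r< : r (ν y) <lex r (ν x) → r (f (ν y)) <lex r (f (ν x))
      r< lt = subst₂ _<lex_ (sym (r∘f leafy)) (sym (r∘f leafx))
                (f-mono-< (IsVertex-restrict _ (IsLeaf⇒IsVertex leafy)) (IsVertex-restrict _ (IsLeaf⇒IsVertex leafx)) lt)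
      transport : NonViolated G (just ∘ ν) x y → NonViolated G (just ∘ f ∘ ν) x y
      transport (inj₁ (ev , inj₁ (fin< lt))) = inj₁ (ev , inj₁ (fin< (r< lt)))
      transport (inj₁ (ev , inj₂ eq))        =
        inj₁ (ev , inj₂ (cong just (trans (r∘f leafx) (trans (cong f (just-injective eq)) (sym (r∘f leafy))))))
      transport (inj₂ (od , inj₁ (fin< lt))) = inj₂ (od , inj₁ (fin< (r< lt)))
      transport (inj₂ (od , inj₂ (() , _)))

  ArcsWithinNodes : Subgraph G → Set
  ArcsWithinNodes H = ∀ {v w} → (v , w) ∈ arcs H → v ∈ nodes H × w ∈ nodes H

  AdmitsFinite-⊑ : ∀ {H S S' j} → ArcsWithinNodes H → HasHeight S j → HasHeight S' j → S ⊑ S' →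
                   AdmitsFinite G H S → AdmitsFinite G H S'
  AdmitsFinite-⊑ within hS hS' (f , e) (ν , leaves , σ , σ-arc , σ-in , nonViolated) =
    f ∘ ν , (λ v v∈ → Embedding.leaf e _ (leaves v v∈)) , σ , σ-arc , σ-in ,
    λ v w vw∈ vw∈Gσ → NonViolated-embed e hS hS' ν (leaves v (proj₁ (within vw∈))) (leaves w (proj₂ (within vw∈)))
                        (nonViolated v w vw∈ vw∈Gσ)

  πmax-ub : ∀ H {x} → x ∈ nodes H → π x ≤ πmax G H
  πmax-ub H = ub (nodes H)
    where
      ub : ∀ xs {x} → x ∈ xs → π x ≤ foldr _⊔_ 0 (map π xs)
      ub (y ∷ xs) (here refl) = m≤m⊔n _ _
      ub (y ∷ xs) (there x∈)  = ≤-trans (ub xs x∈) (m≤n⊔m _ _)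

  πmax-lub : ∀ H {m} → (∀ {x} → x ∈ nodes H → π x ≤ m) → πmax G H ≤ m
  πmax-lub H = lub (nodes H)
    where
      lub : ∀ xs {m} → (∀ {x} → x ∈ xs → π x ≤ m) → foldr _⊔_ 0 (map π xs) ≤ m
      lub []       _  = z≤n
      lub (y ∷ xs) ≤m = ⊔-lub (≤m (here refl)) (lub xs (≤m ∘ there))

-- In a subgraph of G_τ with at most one arc out of each node, Even has no choice left.
module FunctionalSubgraph (G : Game) (τ : OddStrategy G) (τ-arc : IsOddStrategy G τ) (H : Subgraph G)
         (H⊆Gτ : ∀ {v w} → (v , w) ∈ arcs H → Eτ G τ v w)
         (H-functional : ∀ {v w w'} → (v , w) ∈ arcs H → (v , w') ∈ arcs H → w ≡ w') where
  open Game G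

  Eτ-even⇒E : ∀ {v w} → owner v ≡ even → Eτ G τ v w → E v w
  Eτ-even⇒E _  (inj₁ (_ , vw∈E)) = vw∈E
  Eτ-even⇒E ev (inj₂ (od , _)) with trans (sym ev) od
  ... | ()

  σH : EvenStrategy G
  σH v _ with successor? F._≟_ (arcs H) v
  ... | yes (w , _) = w
  ... | no  _       = proj₁ (total v)

  NonViolated⇒Feasible : ∀ {ν} → (∀ {v w} → (v , w) ∈ arcs H → NonViolated G ν v w) → Feasible G H ν
  NonViolated⇒Feasible nonViolated = σH , σH-arc , σH-in , λ _ _ vw∈ _ → nonViolated vw∈
    where
      σH-arc : ∀ v (p : owner v ≡ even) → E v (σH v p)
      σH-arc v ev with successor? F._≟_ (arcs H) v
      ... | yes (w , vw∈) = Eτ-even⇒E ev (H⊆Gτ vw∈)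
      ... | no  _         = proj₂ (total v)
      σH-in : ∀ v (p : owner v ≡ even) → (∃[ w ] (v , w) ∈ arcs H) → (v , σH v p) ∈ arcs H
      σH-in v ev out with successor? F._≟_ (arcs H) v
      ... | yes (w , vw∈) = vw∈
      ... | no  none      = ⊥-elim (none out)

  Feasible⇒NonViolated : ∀ {ν} → Feasible G H ν → ∀ {v w} → (v , w) ∈ arcs H → NonViolated G ν v w
  Feasible⇒NonViolated (σ , _ , σ-in , nonViolated) {v} {w} vw∈ with H⊆Gτ vw∈
  ... | inj₁ (ev , _)      = nonViolated v w vw∈ (inj₂ (ev , H-functional vw∈ (σ-in v ev (w , vw∈))))
  ... | inj₂ (od , refl)   = nonViolated v w vw∈ (inj₁ (od , τ-arc v od))

-- Least indices and maxima

maxℕ : (ℓ : ℕ) → (Fin ℓ → ℕ) → ℕ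
maxℕ zero    _ = 0
maxℕ (suc ℓ) n = n F.zero ⊔ maxℕ ℓ (n ∘ F.suc)

maxℕ-ub : ∀ {ℓ} (n : Fin ℓ → ℕ) i → n i ≤ maxℕ ℓ n
maxℕ-ub n F.zero    = m≤m⊔n _ _
maxℕ-ub n (F.suc i) = ≤-trans (maxℕ-ub (n ∘ F.suc) i) (m≤n⊔m _ _)

maxℕ-lub : ∀ {ℓ} (n : Fin ℓ → ℕ) {m} → (∀ i → n i ≤ m) → maxℕ ℓ n ≤ m
maxℕ-lub {zero}  n _  = z≤n
maxℕ-lub {suc ℓ} n ≤m = ⊔-lub (≤m F.zero) (maxℕ-lub (n ∘ F.suc) (≤m ∘ F.suc))

maxℕ-attained : ∀ {ℓ} (n : Fin ℓ → ℕ) → Fin ℓ → ∃[ i ] n i ≡ maxℕ ℓ n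
maxℕ-attained {suc zero}    n _ = F.zero , sym (⊔-identityʳ (n F.zero))
maxℕ-attained {suc (suc ℓ)} n _ with ≤-total (n F.zero) (maxℕ (suc ℓ) (n ∘ F.suc)) | maxℕ-attained (n ∘ F.suc) F.zero
... | inj₁ ≤rest | i , eq = F.suc i , trans eq (sym (m≤n⇒m⊔n≡n ≤rest))
... | inj₂ ≥rest | _      = F.zero , sym (m≥n⇒m⊔n≡m ≥rest)

max∞-fin : ∀ {ℓ} (a : Fin ℓ → ℕ∞) (n : Fin ℓ → ℕ) → (∀ i → a i ≡ fin (n i)) → max∞ ℓ a ≡ fin (maxℕ ℓ n)
max∞-fin {zero}  a n eq = refl
max∞-fin {suc ℓ} a n eq rewrite eq F.zero | max∞-fin (a ∘ F.suc) (n ∘ F.suc) (eq ∘ F.suc) = refl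

finite⊎max∞≡∞ : ∀ ℓ (a : Fin ℓ → ℕ∞) → (Σ[ n ∈ (Fin ℓ → ℕ) ] ∀ i → a i ≡ fin (n i)) ⊎ max∞ ℓ a ≡ ∞
finite⊎max∞≡∞ zero    a = inj₁ ((λ ()) , λ ())
finite⊎max∞≡∞ (suc ℓ) a with a F.zero in eq | finite⊎max∞≡∞ ℓ (a ∘ F.suc)
... | ∞     | _                = inj₂ refl
... | fin m | inj₂ max≡∞       rewrite max≡∞ = inj₂ refl
... | fin m | inj₁ (n , a≡n)   = inj₁ ((λ { F.zero → m ; (F.suc i) → n i }) , λ { F.zero → eq ; (F.suc i) → a≡n i })

IsLeast : (ℕ → Set) → ℕ∞ → Set
IsLeast Q (fin m) = Q m × (∀ {m'} → m' < m → ¬ Q m')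
IsLeast Q ∞       = ∀ m → ¬ Q m

-- In Q-up, the hypothesis Q k m' only serves to say that the index m' exists.
module _ {ℓ} (Q : Fin ℓ → ℕ → Set) (Q∀ : ℕ → Set) (some : Fin ℓ)
         (Q-up : ∀ {i k m m'} → m ≤ m' → Q k m' → Q i m → Q i m')
         (Q∀⇒Q : ∀ {m} → Q∀ m → ∀ i → Q i m)
         (Q⇒Q∀ : ∀ {m} → (∀ i → Q i m) → Q∀ m) where

  Q∀-maxℕ : (n : Fin ℓ → ℕ) → (∀ i → Q i (n i)) → Q∀ (maxℕ ℓ n)
  Q∀-maxℕ n q with maxℕ-attained n some
  ... | i* , n[i*]≡max = Q⇒Q∀ λ i → Q-up (maxℕ-ub n i) (subst (Q i*) n[i*]≡max (q i*)) (q i)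

  IsLeast-∀≡max∞ : ∀ (a : Fin ℓ → ℕ∞) b → (∀ i → IsLeast (Q i) (a i)) → IsLeast Q∀ b → b ≡ max∞ ℓ a
  IsLeast-∀≡max∞ a (fin m) least (q∀m , minimal) =
    trans (cong fin (≤-antisym (≮⇒≥ λ max<m → minimal max<m (Q∀-maxℕ n (λ i → least-at i (a≡n i)))) (maxℕ-lub n n≤m)))
          (sym (max∞-fin a n a≡n))
    where
      bounded : ∀ {i} x → IsLeast (Q i) x → Q i m → ∃[ k ] (x ≡ fin k × k ≤ m)
      bounded ∞       none         qm = ⊥-elim (none _ qm)
      bounded (fin k) (_ , minimalᵢ) qm = k , refl , ≮⇒≥ λ m<k → minimalᵢ m<k qm
      bound : ∀ i → ∃[ k ] (a i ≡ fin k × k ≤ m)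
      bound i = bounded (a i) (least i) (Q∀⇒Q q∀m i)
      n : Fin ℓ → ℕ
      n = proj₁ ∘ bound
      a≡n : ∀ i → a i ≡ fin (n i)
      a≡n = proj₁ ∘ proj₂ ∘ bound
      n≤m : ∀ i → n i ≤ m
      n≤m = proj₂ ∘ proj₂ ∘ bound
      least-at : ∀ i {k} → a i ≡ fin k → Q i k
      least-at i eq = proj₁ (subst (IsLeast (Q i)) eq (least i))
  IsLeast-∀≡max∞ a ∞ least none with finite⊎max∞≡∞ ℓ a
  ... | inj₂ max≡∞      = sym max≡∞
  ... | inj₁ (n , a≡n) = ⊥-elim (none _ (Q∀-maxℕ n λ i → proj₁ (subst (IsLeast (Q i)) (a≡n i) (least i))))

-- Widths along a chain

module _ (G : Game) where

  AdmitsAt : List OTree → Subgraph G → ℕ → Set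
  AdmitsAt ch H m = Σ[ S ∈ OTree ] (At ch m S × AdmitsFinite G H S)

  WidthIn⇒IsLeast : ∀ {ch H} a → WidthIn G ch H a → IsLeast (AdmitsAt ch H) a
  WidthIn⇒IsLeast (fin m) (S , at , adm , minimal) =
    (S , at , adm) , λ m'<m (S' , at' , adm') → minimal _ S' m'<m at' adm'
  WidthIn⇒IsLeast ∞ none m (S , at , adm) = none m S at adm

  AdmitsAt-mono : ∀ {ch j H m m' S'} → Linked _⊏_ ch → (∀ {n S} → At ch n S → HasHeight S j) →
                  ArcsWithinNodes G H → m ≤ m' → At ch m' S' → AdmitsAt ch H m → AdmitsAt ch H m'
  AdmitsAt-mono chain heights within m≤m' at' (S , at , adm) =
    _ , at' , AdmitsFinite-⊑ G within (heights at) (heights at') (Linked⊏-⊑ chain at at' m≤m') adm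

-- Walks and cycles

module _ (G : Game) where

  walkArcs-∈ : ∀ ps {v w} → (v , w) ∈ walkArcs G ps → v ∈ ps × w ∈ ps
  walkArcs-∈ (x ∷ y ∷ ps) (here refl) = here refl , there (here refl)
  walkArcs-∈ (x ∷ y ∷ ps) (there vw∈) = let v∈ , w∈ = walkArcs-∈ (y ∷ ps) vw∈ in there v∈ , there w∈

  walkArcs-continue : ∀ ps {v w} → (v , w) ∈ walkArcs G ps → last ps ≡ just w ⊎ ∃[ u ] (w , u) ∈ walkArcs G ps
  walkArcs-continue (x ∷ y ∷ [])     (here refl) = inj₁ refl
  walkArcs-continue (x ∷ y ∷ z ∷ ps) (here refl) = inj₂ (z , there (here refl))
  walkArcs-continue (x ∷ y ∷ ps)     (there vw∈) with walkArcs-continue (y ∷ ps) vw∈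
  ... | inj₁ last≡w     = inj₁ last≡w
  ... | inj₂ (u , wu∈) = inj₂ (u , there wu∈)

  walkArcs-incident : ∀ ps {x} → 2 ≤ length ps → x ∈ ps →
                      ∃[ y ] ((x , y) ∈ walkArcs G ps ⊎ (y , x) ∈ walkArcs G ps)
  walkArcs-incident (x ∷ [])         (s≤s ()) _
  walkArcs-incident (x ∷ y ∷ ps)     _ (here refl)         = y , inj₁ (here refl)
  walkArcs-incident (x ∷ y ∷ [])     _ (there (here refl)) = x , inj₂ (here refl)
  walkArcs-incident (x ∷ y ∷ z ∷ ps) _ (there x∈) with walkArcs-incident (y ∷ z ∷ ps) (s≤s (s≤s z≤n)) x∈
  ... | u , inj₁ xu∈ = u , inj₁ (there xu∈)
  ... | u , inj₂ ux∈ = u , inj₂ (there ux∈)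

  map-proj₁-walkArcs : ∀ xs x → map proj₁ (walkArcs G (xs ∷ʳ x)) ≡ xs
  map-proj₁-walkArcs []           x = refl
  map-proj₁-walkArcs (y ∷ [])     x = refl
  map-proj₁-walkArcs (y ∷ z ∷ xs) x = cong (y ∷_) (map-proj₁-walkArcs (z ∷ xs) x)

  map-proj₂-walkArcs : ∀ x xs → map proj₂ (walkArcs G (x ∷ xs)) ≡ xs
  map-proj₂-walkArcs x []       = refl
  map-proj₂-walkArcs x (y ∷ xs) = cong (y ∷_) (map-proj₂-walkArcs y xs)

module Cycle (G : Game) (c : Node G) (cs : List (Node G)) (unique : Unique (c ∷ cs)) where

  C : Subgraph G
  C = cycleSub G (c ∷ cs)

  sources : map proj₁ (arcs C) ≡ c ∷ cs
  sources = map-proj₁-walkArcs G (c ∷ cs) c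

  targets : map proj₂ (arcs C) ≡ cs ∷ʳ c
  targets = map-proj₂-walkArcs G c (cs ∷ʳ c)

  successor-unique : ∀ {v w w'} → (v , w) ∈ arcs C → (v , w') ∈ arcs C → w ≡ w'
  successor-unique vw∈ vw'∈ =
    cong proj₂ (Unique-map⇒injective proj₁ (subst Unique (sym sources) unique) vw∈ vw'∈ refl)

  predecessor-unique : ∀ {v v' w} → (v , w) ∈ arcs C → (v' , w) ∈ arcs C → v ≡ v'
  predecessor-unique vw∈ v'w∈ =
    cong proj₁ (Unique-map⇒injective proj₂ (subst Unique (sym targets) (Unique-resp-↭ unique (∷↭∷ʳ c cs))) vw∈ v'w∈ refl)

  Unique-arcs : Unique (arcs C)
  Unique-arcs = Unique.map⁻ (subst Unique (sym sources) unique)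

  predecessor : ∀ {x} → x ∈ c ∷ cs → ∃[ w ] (w , x) ∈ arcs C
  predecessor x∈ with ∈-map⁻ proj₂ (subst (_ ∈_) (sym targets) (∈-resp-↭ (∷↭∷ʳ c cs) x∈))
  ... | (w , _) , wx∈ , refl = w , wx∈

  C-within : ArcsWithinNodes G C
  C-within vw∈ = subst (_ ∈_) sources (∈-map⁺ proj₁ vw∈) ,
                 ∈-resp-↭ (↭-sym (∷↭∷ʳ c cs)) (subst (_ ∈_) targets (∈-map⁺ proj₂ vw∈))

-- Decomposing a cycle of G_τ into paths

module Decomposition (G : Game) (τ : OddStrategy G) (τ-arc : IsOddStrategy G τ)
    (c : Node G) (cs : List (Node G)) (unique : Unique (c ∷ cs))
    (C⊆Gτ : ∀ v w → (v , w) ∈ cycArcs G (c ∷ cs) → Eτ G τ v w)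
    (ℓ : ℕ) (v : Fin ℓ → Node G) (v-top : ∀ i → Game.π G (v i) ≡ πmax G (cycleSub G (c ∷ cs)))
    (P : Fin ℓ → List (Node G)) (P-long : ∀ i → 2 ≤ length (P i)) (P-last : ∀ i → last (P i) ≡ just (v i))
    (P↭C : concat (map (walkArcs G ∘ P) (allFin ℓ)) ↭ cycArcs G (c ∷ cs)) where

  open Game G
  open Cycle G c cs unique public

  Path : Fin ℓ → Subgraph G
  Path i = pathSub G (P i)

  Path⊆C : ∀ {i a} → a ∈ arcs (Path i) → a ∈ arcs C
  Path⊆C {i} a∈ = ∈-resp-↭ P↭C (∈-concat⁺′ a∈ (∈-map⁺ (walkArcs G ∘ P) (∈-allFin i)))

  arc-Path : ∀ {a} → a ∈ arcs C → ∃[ i ] a ∈ arcs (Path i)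
  arc-Path a∈ with ∈-concat⁻′ (map (walkArcs G ∘ P) (allFin ℓ)) (∈-resp-↭ (↭-sym P↭C) a∈)
  ... | _ , a∈P , P∈ with ∈-map⁻ (walkArcs G ∘ P) P∈
  ...   | i , _ , refl = i , a∈P

  Path-unique : ∀ {a i i'} → a ∈ arcs (Path i) → a ∈ arcs (Path i') → i ≡ i'
  Path-unique {i = i} {i'} =
    Unique-concat⇒disjoint (walkArcs G ∘ P) (allFin ℓ) (Unique-resp-↭ Unique-arcs (↭-sym P↭C)) (∈-allFin i) (∈-allFin i')

  Path-nodes : ∀ i {x} → x ∈ P i → x ∈ c ∷ cs
  Path-nodes i x∈ with walkArcs-incident G (P i) (P-long i) x∈
  ... | _ , inj₁ xy∈ = proj₁ (C-within (Path⊆C {i} xy∈))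
  ... | _ , inj₂ yx∈ = proj₂ (C-within (Path⊆C {i} yx∈))

  πmax-Path : ∀ i → πmax G (Path i) ≡ πmax G C
  πmax-Path i = ≤-antisym (πmax-lub G (Path i) (πmax-ub G C ∘ Path-nodes i))
                          (subst (_≤ πmax G (Path i)) (v-top i) (πmax-ub G (Path i) (last-∈ (P i) (P-last i))))

  some-Path : Fin ℓ
  some-Path = proj₁ (arc-Path (proj₂ (predecessor (here refl))))

  -- the vᵢ are the only nodes at which paths end
  Path-continues : ∀ {i w x y} → π x ≢ πmax G C → (w , x) ∈ arcs (Path i) → (x , y) ∈ arcs C → (x , y) ∈ arcs (Path i)
  Path-continues {i} {x = x} ¬top wx∈ xy∈ with walkArcs-continue G (P i) wx∈
  ... | inj₁ last≡x     = ⊥-elim (¬top (trans (cong π (just-injective (trans (sym last≡x) (P-last i)))) (v-top i)))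
  ... | inj₂ (u , xu∈) = subst (λ z → (x , z) ∈ arcs (Path i)) (successor-unique (Path⊆C {i} xu∈) xy∈) xu∈

  module C-functional = FunctionalSubgraph G τ τ-arc C (C⊆Gτ _ _) successor-unique
  module Path-functional (i : Fin ℓ) =
    FunctionalSubgraph G τ τ-arc (Path i) (C⊆Gτ _ _ ∘ Path⊆C {i}) (λ a∈ b∈ → successor-unique (Path⊆C {i} a∈) (Path⊆C {i} b∈))

  AdmitsFinite-Path : ∀ {S} i → AdmitsFinite G C S → AdmitsFinite G (Path i) S
  AdmitsFinite-Path i (ν , leaves , feasible) =
    ν , (λ x x∈ → leaves x (Path-nodes i x∈)) ,
    Path-functional.NonViolated⇒Feasible i (λ xy∈ → C-functional.Feasible⇒NonViolated feasible (Path⊆C {i} xy∈))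

  module Glue {S j} (hS : HasHeight S j) (2j≡π : 2 * j ≡ πmax G C) (π-even : πmax G C % 2 ≡ 0)
              (adm : ∀ i → AdmitsFinite G (Path i) S) where

    ν : Fin ℓ → Node G → List ℕ
    ν i = proj₁ (adm i)

    ν-leaf : ∀ i {x} → x ∈ P i → IsLeaf S (ν i x)
    ν-leaf i = proj₁ (proj₂ (adm i)) _

    glued : Node G → List ℕ
    glued x with predecessor? F._≟_ (arcs C) x
    ... | yes (_ , wx∈) = ν (proj₁ (arc-Path wx∈)) x
    ... | no  _         = []

    glued-Path : ∀ {i w x} → (w , x) ∈ arcs (Path i) → glued x ≡ ν i x
    glued-Path {i} {w} {x} wx∈ with predecessor? F._≟_ (arcs C) x
    ... | yes (w' , w'x∈) = cong (λ k → ν k x) (Path-unique (proj₂ (arc-Path w'x∈))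
                              (subst (λ u → (u , x) ∈ arcs (Path i)) (predecessor-unique (Path⊆C {i} wx∈) w'x∈) wx∈))
    ... | no  none        = ⊥-elim (none (w , Path⊆C {i} wx∈))

    glued-leaf : ∀ x → x ∈ c ∷ cs → IsLeaf S (glued x)
    glued-leaf x x∈ with predecessor x∈
    ... | _ , wx∈ with arc-Path wx∈
    ...   | i , wx∈P = subst (IsLeaf S) (sym (glued-Path wx∈P)) (ν-leaf i (proj₂ (walkArcs-∈ G (P i) wx∈P)))

    restrict-glued : ∀ {x} p → πmax G C ≤ p → x ∈ c ∷ cs → restrict p (glued x) ≡ []
    restrict-glued {x} p π≤p x∈ =
      restrict-[] p (glued x) (≤-trans (≤-reflexive (trans (cong (2 *_) (hS _ (glued-leaf x x∈))) 2j≡π)) π≤p)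

    glued-nonViolated : ∀ {x y} → (x , y) ∈ arcs C → NonViolated G (just ∘ glued) x y
    glued-nonViolated {x} {y} xy∈ with π x ≟ πmax G C
    ... | yes top = inj₁ (subst (λ p → p % 2 ≡ 0) (sym top) π-even ,
                          inj₂ (cong just (trans (restrict-glued _ π≤πx x∈) (sym (restrict-glued _ π≤πx y∈)))))
      where
        π≤πx = ≤-reflexive (sym top)
        x∈ = proj₁ (C-within xy∈)
        y∈ = proj₂ (C-within xy∈)
    ... | no ¬top with arc-Path xy∈ | predecessor (proj₁ (C-within xy∈))
    ...   | i , xy∈P | w , wx∈ with arc-Path wx∈
    ...     | i' , wx∈P' =
      NonViolated-cong G {just ∘ ν i} {just ∘ glued} (cong just (sym glued-x)) (cong just (sym (glued-Path xy∈P)))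
        (Path-functional.Feasible⇒NonViolated i (proj₂ (proj₂ (adm i))) xy∈P)
      where
        glued-x : glued x ≡ ν i x
        glued-x = trans (glued-Path wx∈P') (cong (λ k → ν k x) (Path-unique (Path-continues ¬top wx∈P' xy∈) xy∈P))

    AdmitsFinite-C : AdmitsFinite G C S
    AdmitsFinite-C = glued , glued-leaf , C-functional.NonViolated⇒Feasible glued-nonViolated

  module _ {ch : List OTree} {j} (chain : Linked _⊏_ ch) (heights : ∀ {m S} → At ch m S → HasHeight S j)
           (2j≡π : 2 * j ≡ πmax G C) (π-even : πmax G C % 2 ≡ 0) where

    AdmitsAt-glue : ∀ {m} → (∀ i → AdmitsAt G ch (Path i) m) → AdmitsAt G ch C m
    AdmitsAt-glue adm with adm some-Path
    ... | S , at , _ = S , at , Glue.AdmitsFinite-C (heights at) 2j≡π π-even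
                         λ i → let _ , atᵢ , admᵢ = adm i in subst (AdmitsFinite G (Path i)) (At-functional atᵢ at) admᵢ

    width-C≡max : ∀ a b → (∀ i → WidthIn G ch (Path i) (a i)) → WidthIn G ch C b → b ≡ max∞ ℓ a
    width-C≡max a b αP αC =
      IsLeast-∀≡max∞ (λ i → AdmitsAt G ch (Path i)) (AdmitsAt G ch C) some-Path
        (λ m≤m' (_ , at' , _) → AdmitsAt-mono G chain heights (walkArcs-∈ G (P _)) m≤m' at')
        (λ (S , at , adm) i → S , at , AdmitsFinite-Path i adm)
        AdmitsAt-glue
        a b (λ i → WidthIn⇒IsLeast G (a i) (αP i)) (WidthIn⇒IsLeast G b αC)

lemma4p6 : (G : Game) (τ : OddStrategy G) → IsOddStrategy G τ →
    (T : OTree) (h : ℕ) → 2 * h ≡ Game.d G → HasHeight T h →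
    (𝒯 : ℕ → List OTree) → (∀ j → j ≤ h → IsTj T h j (𝒯 j)) →
    (𝒞 : ℕ → List (List OTree)) → (∀ j → j ≤ h → IsCoverOf (𝒯 j) (𝒞 j)) →
    (cs : List (Node G)) → IsCycleIn G τ cs → πmax G (cycleSub G cs) % 2 ≡ 0 →
    (ℓ : ℕ) (v : Fin ℓ → Node G) → Enumerates-Π G cs ℓ v →
    (P : Fin ℓ → List (Node G)) → IsDecomposition G cs ℓ v P →
    (k : ℕ) → k < length (𝒞 ⌊ πmax G (cycleSub G cs) /2⌋) →
    (a : Fin ℓ → ℕ∞) (b : ℕ∞) →
    (∀ i → WidthIs G 𝒞 k (pathSub G (P i)) (a i)) →
    WidthIs G 𝒞 k (cycleSub G cs) b →
    b ≡ max∞ ℓ a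
lemma4p6 G τ τ-arc T h 2h≡d hT 𝒯 𝒯-ok 𝒞 𝒞-ok [] (() , _)
lemma4p6 G τ τ-arc T h 2h≡d hT 𝒯 𝒯-ok 𝒞 𝒞-ok (c ∷ cs) (_ , unique , C⊆Gτ) π-even ℓ v (_ , v-top , _)
         P (P-long , P-last , P↭C) k _ a b αP (ch , ch∈𝒞 , αC) =
  width-C≡max chain heights 2j≡π π-even a b αP-ch αC
  where
    open Decomposition G τ τ-arc c cs unique C⊆Gτ ℓ v (proj₂ ∘ v-top) P P-long P-last P↭C
    j : ℕ
    j = ⌈ πmax G C /2⌉
    2j≡π : 2 * j ≡ πmax G C
    2j≡π = 2*⌈n/2⌉≡n (πmax G C) π-even
    j≤h : j ≤ h
    j≤h = *-cancelˡ-≤ 2 (subst₂ _≤_ (sym 2j≡π) (sym 2h≡d) (πmax-lub G C λ {x} _ → Game.π-le G x))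
    chain : Linked _⊏_ ch
    chain = IsCoverOf.chain (𝒞-ok j j≤h) ch (At⇒∈ ch∈𝒞)
    heights : ∀ {m S} → At ch m S → HasHeight S j
    heights at = cover-HasHeight hT j≤h (𝒯-ok j j≤h) (𝒞-ok j j≤h) (At⇒∈ ch∈𝒞) (At⇒∈ at)
    αP-ch : ∀ i → WidthIn G ch (Path i) (a i)
    αP-ch i with αP i
    ... | chᵢ , chᵢ∈𝒞 , αPᵢ =
      subst (λ ch' → WidthIn G ch' (Path i) (a i))
            (At-functional (subst (λ p → At (𝒞 ⌈ p /2⌉) k chᵢ) (πmax-Path i) chᵢ∈𝒞) ch∈𝒞) αPᵢ
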